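{- Let $R$ be a finite commutative ring with unity and $\Gamma'(R)$ its cozero-divisor graph. Let $X_1,\dots,X_k$ be the equivalence classes of the relation $\equiv$ on $V(\Gamma'(R))$ given by $x\equiv y\iff (x)=(y)$, let $x_i\in X_i$ be representatives, let $\Upsilon'(R)$ be the subgraph of $\Gamma'(R)$ induced by $\{x_1,\dots,x_k\}$, and let $\Gamma'_i$ be the subgraph of $\Gamma'(R)$ induced by $X_i$. Then $\Gamma'(R)=\Upsilon'(R)[\Gamma'_1,\Gamma'_2,\dots,\Gamma'_k]$ (generalised join, where $\Gamma'_i$ replaces the vertex $x_i$).
   Context: The cozero-divisor graph $\Gamma'(R)$ of a ring $R$ with unity is the simple undirected graph whose vertices are the non-zero non-unit elements of $R$, with distinct vertices $x,y$ adjacent iff $x\notin Ry$ and $y\notin Rx$. $(x)$ is the principal ideal generated by $x$. For a graph $\Gamma$ with vertices $u_1,\dots,u_k$ and pairwise disjoint graphs $\Gamma_1,\dots,\Gamma_k$, the generalised join $\Gamma[\Gamma_1,\dots,\Gamma_k]$ is obtained by replacing each $u_i$ by $\Gamma_i$ and joining every vertex of $\Gamma_i$ to every vertex of $\Gamma_j$ whenever $u_i\sim u_j$ in $\Gamma$. -}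

module Defs where

open import Level using (Level; _⊔_)
open import Data.Nat using (ℕ)
open import Data.Fin using (Fin)
open import Data.Product using (Σ; ∃; _×_; _,_; proj₁; proj₂)
open import Data.Sum using (_⊎_)
open import Relation.Nullary using (¬_)
open import Relation.Binary.PropositionalEquality using (_≡_; _≢_; subst)
open import Algebra.Bundles using (CommutativeRing)

-- Graphs: a vertex type with an equality (setoid-style, since ring
-- elements are compared with the ring's _≈_) and an adjacency relation.

record Graph (v e a : Level) : Set (Level.suc (v ⊔ e ⊔ a)) where
  field
    Vertex : Set v
    _≈ᵥ_   : Vertex → Vertex → Set e
    _∼_    : Vertex → Vertex → Set a

open Graph public

induced : ∀ {v e a p} (Γ : Graph v e a) → (Vertex Γ → Set p) → Graph (v ⊔ p) e a
induced Γ P = record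
  { Vertex = Σ (Vertex Γ) P
  ; _≈ᵥ_   = λ x y → _≈ᵥ_ Γ (proj₁ x) (proj₁ y)
  ; _∼_    = λ x y → _∼_ Γ (proj₁ x) (proj₁ y)
  }

-- Generalised join Γ[Γ₁,…,Γₖ]: Γ has vertices u₁,…,uₖ (given by u),
-- each uᵢ is replaced by Γᵢ; inside a Γᵢ the adjacency is that of Γᵢ,
-- and a vertex of Γᵢ is joined to a vertex of Γⱼ (i ≠ j) iff uᵢ ∼ uⱼ in Γ.
generalisedJoin : ∀ {v e a v' e' a'} (Γ : Graph v e a) (k : ℕ) (u : Fin k → Vertex Γ)
                  (Γs : Fin k → Graph v' e' a') → Graph v' e' (a ⊔ a')
generalisedJoin Γ k u Γs = record
  { Vertex = Σ (Fin k) (λ i → Vertex (Γs i))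
  ; _≈ᵥ_   = λ { (i , x) (j , y) → Σ (i ≡ j) (λ p → _≈ᵥ_ (Γs j) (subst (λ l → Vertex (Γs l)) p x) y) }
  ; _∼_    = λ { (i , x) (j , y) →
                   (Σ (i ≡ j) (λ p → _∼_ (Γs j) (subst (λ l → Vertex (Γs l)) p x) y))
                 ⊎ (i ≢ j × _∼_ Γ (u i) (u j)) }
  }

record IsGraphIso {v e a v' e' a'} (Δ : Graph v e a) (Γ : Graph v' e' a')
                  (f : Vertex Δ → Vertex Γ) : Set (v ⊔ e ⊔ a ⊔ v' ⊔ e' ⊔ a') where
  field
    respects  : ∀ x y → _≈ᵥ_ Δ x y → _≈ᵥ_ Γ (f x) (f y)
    reflects  : ∀ x y → _≈ᵥ_ Γ (f x) (f y) → _≈ᵥ_ Δ x y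
    surjective : ∀ y → ∃ λ x → _≈ᵥ_ Γ (f x) y
    adj⇒      : ∀ x y → _∼_ Δ x y → _∼_ Γ (f x) (f y)
    adj⇐      : ∀ x y → _∼_ Γ (f x) (f y) → _∼_ Δ x y

module _ {c ℓ} (R : CommutativeRing c ℓ) where
  open CommutativeRing R

  IsFiniteRing : Set (c ⊔ ℓ)
  IsFiniteRing = Σ ℕ λ n → Σ (Fin n → Carrier) λ f → ∀ x → ∃ λ i → f i ≈ x

  _∈⟨_⟩ : Carrier → Carrier → Set (c ⊔ ℓ)
  x ∈⟨ y ⟩ = ∃ λ r → x ≈ r * y

  IsUnit : Carrier → Set (c ⊔ ℓ)
  IsUnit x = ∃ λ u → x * u ≈ 1#

  SameIdeal : Carrier → Carrier → Set (c ⊔ ℓ)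
  SameIdeal x y = x ∈⟨ y ⟩ × y ∈⟨ x ⟩

  IsCozeroVertex : Carrier → Set (c ⊔ ℓ)
  IsCozeroVertex x = ¬ (x ≈ 0#) × ¬ IsUnit x

  cozeroGraph : Graph (c ⊔ ℓ) ℓ (c ⊔ ℓ)
  cozeroGraph = record
    { Vertex = Σ Carrier IsCozeroVertex
    ; _≈ᵥ_   = λ x y → proj₁ x ≈ proj₁ y
    ; _∼_    = λ x y → ¬ (proj₁ x ≈ proj₁ y) × ¬ (proj₁ x ∈⟨ proj₁ y ⟩) × ¬ (proj₁ y ∈⟨ proj₁ x ⟩)
    }

  record AreClassRepresentatives (k : ℕ) (x : Fin k → Carrier) : Set (c ⊔ ℓ) where
    field
      isVertex : ∀ i → IsCozeroVertex (x i)
      distinct : ∀ i j → SameIdeal (x i) (x j) → i ≡ j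
      covering : ∀ v → IsCozeroVertex v → ∃ λ i → SameIdeal v (x i)

  InClass : ∀ {k} → (Fin k → Carrier) → Fin k → Vertex cozeroGraph → Set (c ⊔ ℓ)
  InClass x i v = SameIdeal (proj₁ v) (x i)

  classGraph : ∀ {k} → (Fin k → Carrier) → Fin k → Graph (c ⊔ ℓ) ℓ (c ⊔ ℓ)
  classGraph x i = induced cozeroGraph (InClass x i)

  upsilonGraph : ∀ {k} → (Fin k → Carrier) → Graph (c ⊔ ℓ) ℓ (c ⊔ ℓ)
  upsilonGraph {k} x = induced cozeroGraph (λ v → ∃ λ (i : Fin k) → proj₁ v ≈ x i)

  upsilonVertex : ∀ {k} (x : Fin k → Carrier) → (∀ i → IsCozeroVertex (x i)) →
                  Fin k → Vertex (upsilonGraph x)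
  upsilonVertex x isV i = (x i , isV i) , (i , refl)

  joinGraph : ∀ k (x : Fin k → Carrier) → (∀ i → IsCozeroVertex (x i)) →
              Graph (c ⊔ ℓ) ℓ (c ⊔ ℓ)
  joinGraph k x isV = generalisedJoin (upsilonGraph x) k (upsilonVertex x isV) (classGraph x)

  joinToCozero : ∀ k (x : Fin k → Carrier) (isV : ∀ i → IsCozeroVertex (x i)) →
                 Vertex (joinGraph k x isV) → Vertex cozeroGraph
  joinToCozero k x isV (i , v) = proj₁ v

{-# OPTIONS --safe #-}
-- The relation (x) = (y) makes every ring-theoretic ingredient of Γ'(R) a
-- class invariant: whether x ∈ Ry and y ∈ Rx hold depends only on the
-- classes of x and y. Hence two vertices in different classes Xᵢ, Xⱼ are
-- adjacent exactly when the representatives xᵢ, xⱼ are, which is the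
-- adjacency of the generalised join; inside one class the adjacency is by
-- definition that of Γ'ᵢ. Vertices of distinct classes are never equal,
-- so the identification ⊔ Xᵢ → V(Γ'(R)) also reflects vertex equality.
module Submission where

open import Defs
open import Data.Nat using (ℕ)
open import Data.Fin using (Fin; _≟_)
open import Data.Product using (Σ; _×_; _,_)
open import Data.Sum using (inj₁; inj₂)
open import Relation.Nullary using (¬_; yes; no)
open import Relation.Binary.PropositionalEquality using (_≡_; refl)
open import Algebra.Bundles using (CommutativeRing)
open import Level using (_⊔_)

module _ {c ℓ} (R : CommutativeRing c ℓ) where
  open CommutativeRing R hiding (refl)

  ∈⟨⟩-trans : ∀ {a b d} → _∈⟨_⟩ R a b → _∈⟨_⟩ R b d → _∈⟨_⟩ R a d
  ∈⟨⟩-trans {d = d} (r , a≈rb) (s , b≈sd) =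
    r * s , trans a≈rb (trans (*-congˡ b≈sd) (sym (*-assoc r s d)))

  ≈⇒∈⟨⟩ : ∀ {a b} → a ≈ b → _∈⟨_⟩ R a b
  ≈⇒∈⟨⟩ a≈b = 1# , trans a≈b (sym (*-identityˡ _))

  ≈⇒SameIdeal : ∀ {a b} → a ≈ b → SameIdeal R a b
  ≈⇒SameIdeal a≈b = ≈⇒∈⟨⟩ a≈b , ≈⇒∈⟨⟩ (sym a≈b)

  SameIdeal-sym : ∀ {a b} → SameIdeal R a b → SameIdeal R b a
  SameIdeal-sym (a∈b , b∈a) = b∈a , a∈b

  SameIdeal-trans : ∀ {a b d} → SameIdeal R a b → SameIdeal R b d → SameIdeal R a d
  SameIdeal-trans (a∈b , b∈a) (b∈d , d∈b) = ∈⟨⟩-trans a∈b b∈d , ∈⟨⟩-trans d∈b b∈a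

  ∈⟨⟩-resp-SameIdeal : ∀ {a a′ b b′} → SameIdeal R a a′ → SameIdeal R b b′ →
                       _∈⟨_⟩ R a b → _∈⟨_⟩ R a′ b′
  ∈⟨⟩-resp-SameIdeal (_ , a′∈a) (b∈b′ , _) a∈b = ∈⟨⟩-trans a′∈a (∈⟨⟩-trans a∈b b∈b′)

  Incomparable : Carrier → Carrier → Set (c ⊔ ℓ)
  Incomparable a b = ¬ _∈⟨_⟩ R a b × ¬ _∈⟨_⟩ R b a

  Incomparable-resp-SameIdeal : ∀ {a a′ b b′} → SameIdeal R a a′ → SameIdeal R b b′ →
                                Incomparable a b → Incomparable a′ b′
  Incomparable-resp-SameIdeal a~a′ b~b′ (a∉b , b∉a) =
    (λ a′∈b′ → a∉b (∈⟨⟩-resp-SameIdeal (SameIdeal-sym a~a′) (SameIdeal-sym b~b′) a′∈b′)) ,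
    (λ b′∈a′ → b∉a (∈⟨⟩-resp-SameIdeal (SameIdeal-sym b~b′) (SameIdeal-sym a~a′) b′∈a′))

  module _ {k : ℕ} {x : Fin k → Carrier} (reps : AreClassRepresentatives R k x) where
    open AreClassRepresentatives reps

    private
      Γ′ : Graph (c ⊔ ℓ) ℓ (c ⊔ ℓ)
      Γ′ = cozeroGraph R

      J : Graph (c ⊔ ℓ) ℓ (c ⊔ ℓ)
      J = joinGraph R k x isVertex

      φ : Vertex J → Vertex Γ′
      φ = joinToCozero R k x isVertex

    class-unique : ∀ {i j a} → SameIdeal R a (x i) → SameIdeal R a (x j) → i ≡ j
    class-unique a~xᵢ a~xⱼ = distinct _ _ (SameIdeal-trans (SameIdeal-sym a~xᵢ) a~xⱼ)

    join-respects : ∀ p q → _≈ᵥ_ J p q → _≈ᵥ_ Γ′ (φ p) (φ q)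
    join-respects _ _ (refl , v≈w) = v≈w

    join-reflects : ∀ p q → _≈ᵥ_ Γ′ (φ p) (φ q) → _≈ᵥ_ J p q
    join-reflects (i , (_ , v~xᵢ)) (j , (_ , w~xⱼ)) v≈w
      with class-unique v~xᵢ (SameIdeal-trans (≈⇒SameIdeal v≈w) w~xⱼ)
    ... | refl = refl , v≈w

    join-surjective : ∀ v → Σ (Vertex J) λ p → _≈ᵥ_ Γ′ (φ p) v
    join-surjective v@(a , isVertexₐ) with covering a isVertexₐ
    ... | i , a~xᵢ = (i , (v , a~xᵢ)) , CommutativeRing.refl R

    join-adj⇒ : ∀ p q → _∼_ J p q → _∼_ Γ′ (φ p) (φ q)
    join-adj⇒ _ _ (inj₁ (refl , v∼w)) = v∼w
    join-adj⇒ (i , (_ , v~xᵢ)) (j , (_ , w~xⱼ)) (inj₂ (i≢j , (_ , xᵢ⋈xⱼ))) =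
      (λ v≈w → i≢j (class-unique v~xᵢ (SameIdeal-trans (≈⇒SameIdeal v≈w) w~xⱼ))) ,
      Incomparable-resp-SameIdeal (SameIdeal-sym v~xᵢ) (SameIdeal-sym w~xⱼ) xᵢ⋈xⱼ

    join-adj⇐ : ∀ p q → _∼_ Γ′ (φ p) (φ q) → _∼_ J p q
    join-adj⇐ (i , (_ , v~xᵢ)) (j , (_ , w~xⱼ)) v∼w@(_ , v⋈w) with i ≟ j
    ... | yes refl = inj₁ (refl , v∼w)
    ... | no i≢j   = inj₂ (i≢j ,
      (λ xᵢ≈xⱼ → i≢j (distinct i j (≈⇒SameIdeal xᵢ≈xⱼ))) ,
      Incomparable-resp-SameIdeal v~xᵢ w~xⱼ v⋈w)

    joinToCozero-isGraphIso : IsGraphIso J Γ′ φ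
    joinToCozero-isGraphIso = record
      { respects   = join-respects
      ; reflects   = join-reflects
      ; surjective = join-surjective
      ; adj⇒       = join-adj⇒
      ; adj⇐       = join-adj⇐
      }

proposition2p4 : ∀ {c ℓ} (R : CommutativeRing c ℓ) → IsFiniteRing R →
    (k : ℕ) (x : Fin k → CommutativeRing.Carrier R) (reps : AreClassRepresentatives R k x) →
    IsGraphIso (joinGraph R k x (AreClassRepresentatives.isVertex reps)) (cozeroGraph R)
      (joinToCozero R k x (AreClassRepresentatives.isVertex reps))
proposition2p4 R _ k x reps = joinToCozero-isGraphIso R reps
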